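{- The sums $\sum_{i=0}^{N}(n,m)_i$ of higher tier binomial coefficients over tier $i$ are given by \[ \sum_{j=0}^n(-1)^j\binom{n+m+1-j}{m+1}\zeta_{N+1}(\{1\}_j)\zeta^{\star}_{N+1}(\{1\}_{n+m+1-j}). \]
   Context: The tier-$i$ binomial coefficients are $(n,m)_i=\frac{1}{i+1}\sum_{k=0}^{n}(-1)^k\binom{n-k+m}{m}\zeta_{i}(\{1\}_{k})\zeta^{\star}_{i+1}(\{1\}_{n-k+m})$ for $i,n,m\ge0$, where $\zeta_n(\{1\}_k)=\sum_{n\ge\ell_1>\cdots>\ell_k\ge1}(\ell_1\cdots\ell_k)^{ -1}$ and $\zeta^{\star}_n(\{1\}_k)=\sum_{n\ge\ell_1\ge\cdots\ge\ell_k\ge1}(\ell_1\cdots\ell_k)^{ -1}$; their generating function is $\sum_{n,m}(n,m)_ix^ny^m=\frac{(i-x)(i-1-x)\cdots(1-x)}{(i+1-x-y)(i-x-y)\cdots(1-x-y)}$. -}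

module Defs where

open import Data.Nat using (ℕ; zero; suc; _+_; _∸_)
open import Data.Nat.Combinatorics using (_C_)
open import Data.Integer using (+_)
open import Data.Rational using (ℚ; 0ℚ; 1ℚ; _/_; -_) renaming (_+_ to _+ℚ_; _*_ to _*ℚ_)

Σ≤ : ℕ → (ℕ → ℚ) → ℚ
Σ≤ zero    f = f 0
Σ≤ (suc n) f = Σ≤ n f +ℚ f (suc n)

Σ1 : ℕ → (ℕ → ℚ) → ℚ
Σ1 zero    f = 0ℚ
Σ1 (suc n) f = Σ1 n f +ℚ f (suc n)

inv-suc : ℕ → ℚ
inv-suc ℓ = + 1 / suc ℓ

-- ζ_n({1}_k) = Σ_{n ≥ ℓ₁ > ... > ℓ_k ≥ 1} 1/(ℓ₁⋯ℓ_k),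
-- computed by splitting off the largest index ℓ₁ = ℓ:
-- ζ_n({1}_0) = 1,  ζ_n({1}_{k+1}) = Σ_{ℓ=1}^{n} (1/ℓ) ζ_{ℓ-1}({1}_k)
ζ : ℕ → ℕ → ℚ
ζ n zero    = 1ℚ
ζ n (suc k) = Σ1 n (λ ℓ → inv-suc (ℓ ∸ 1) *ℚ ζ (ℓ ∸ 1) k)

-- ζ*_n({1}_k) = Σ_{n ≥ ℓ₁ ≥ ... ≥ ℓ_k ≥ 1} 1/(ℓ₁⋯ℓ_k):
-- ζ*_n({1}_0) = 1,  ζ*_n({1}_{k+1}) = Σ_{ℓ=1}^{n} (1/ℓ) ζ*_ℓ({1}_k)
ζ⋆ : ℕ → ℕ → ℚ
ζ⋆ n zero    = 1ℚ
ζ⋆ n (suc k) = Σ1 n (λ ℓ → inv-suc (ℓ ∸ 1) *ℚ ζ⋆ ℓ k)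

sgn : ℕ → ℚ
sgn zero    = 1ℚ
sgn (suc k) = - sgn k

ℕ→ℚ : ℕ → ℚ
ℕ→ℚ n = + n / 1

tierBinom : ℕ → ℕ → ℕ → ℚ
tierBinom i n m =
  inv-suc i *ℚ Σ≤ n (λ k → sgn k *ℚ ℕ→ℚ ((n ∸ k + m) C m) *ℚ ζ i k *ℚ ζ⋆ (suc i) (n ∸ k + m))

module Submission where

-- Fix n, m and let
--   R M = Σ_{j≤n} (-1)^j C(n+m+1-j, m+1) ζ_M({1}_j) ζ*_M({1}_{n+m+1-j}),
-- so the right-hand side of the theorem is R (N+1).  Since ζ*_0({1}_K) = 0
-- for K ≥ 1 we have R 0 = 0, and the theorem follows by telescoping from
--   R (i+1) = R i + (n,m)_i .
-- To see this, raise the tier by one in both factors: splitting off the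
-- largest index ℓ = i+1 gives
--   ζ_{i+1}({1}_k)   = ζ_i({1}_k)   + ζ_i({1}_{k-1}) / (i+1),
--   ζ*_{i+1}({1}_{K+1}) = ζ*_i({1}_{K+1}) + ζ*_{i+1}({1}_K) / (i+1).
-- Multiplying out, R (i+1) - R i is 1/(i+1) times two sums.  Shifting the
-- index of the second one (its boundary terms vanish) and merging with the
-- first via Pascal's rule C(K+1, m+1) - C(K, m+1) = C(K, m) leaves exactly
-- the sum defining (n,m)_i.

open import Defs
open import Data.Nat using (ℕ; zero; suc; _+_; _∸_; _≤_; z≤n)
open import Data.Nat.Combinatorics using (_C_; nCk+nC[k+1]≡[n+1]C[k+1]; k>n⇒nCk≡0)
import Data.Nat.Properties as ℕP
import Data.Integer as ℤ
import Data.Integer.Properties as ℤP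
open import Data.Nat.Coprimality using (1-coprimeTo)
import Data.Nat.Coprimality as Coprime
open import Data.Rational using (ℚ; 0ℚ; 1ℚ; mkℚ; _/_; -_) renaming (_+_ to _+ℚ_; _*_ to _*ℚ_)
open import Data.Rational.Properties using (normalize-coprime)
import Data.Rational.Properties as ℚP
open import Data.Rational.Solver using (module +-*-Solver)
open +-*-Solver
open import Relation.Binary.PropositionalEquality
  using (_≡_; refl; sym; trans; cong; cong₂; module ≡-Reasoning)
open ≡-Reasoning

ℕ→ℚ-as-mkℚ : ∀ a → ℕ→ℚ a ≡ mkℚ (ℤ.+ a) 0 (Coprime.sym (1-coprimeTo a))
ℕ→ℚ-as-mkℚ a = normalize-coprime (Coprime.sym (1-coprimeTo a))

ℕ→ℚ-+ : ∀ a b → ℕ→ℚ (a + b) ≡ ℕ→ℚ a +ℚ ℕ→ℚ b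
ℕ→ℚ-+ a b rewrite ℕ→ℚ-as-mkℚ a | ℕ→ℚ-as-mkℚ b =
  cong (_/ 1) (cong₂ ℤ._+_ (sym (ℤP.*-identityʳ (ℤ.+ a))) (sym (ℤP.*-identityʳ (ℤ.+ b))))

pascal : ∀ K m → ℕ→ℚ (suc K C (m + 1)) ≡ ℕ→ℚ (K C m) +ℚ ℕ→ℚ (K C (m + 1))
pascal K m rewrite ℕP.+-comm m 1 =
  trans (cong ℕ→ℚ (sym (nCk+nC[k+1]≡[n+1]C[k+1] K m))) (ℕ→ℚ-+ (K C m) (K C suc m))

Σ≤-cong : ∀ n {f g : ℕ → ℚ} → (∀ k → k ≤ n → f k ≡ g k) → Σ≤ n f ≡ Σ≤ n g
Σ≤-cong zero    f≗g = f≗g 0 z≤n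
Σ≤-cong (suc n) f≗g =
  cong₂ _+ℚ_ (Σ≤-cong n (λ k k≤n → f≗g k (ℕP.m≤n⇒m≤1+n k≤n))) (f≗g (suc n) ℕP.≤-refl)

Σ≤-vanish : ∀ n (f : ℕ → ℚ) → (∀ k → k ≤ n → f k ≡ 0ℚ) → Σ≤ n f ≡ 0ℚ
Σ≤-vanish zero    f f≡0 = f≡0 0 z≤n
Σ≤-vanish (suc n) f f≡0
  rewrite Σ≤-vanish n f (λ k k≤n → f≡0 k (ℕP.m≤n⇒m≤1+n k≤n)) | f≡0 (suc n) ℕP.≤-refl = refl

Σ≤-+ : ∀ n (f g : ℕ → ℚ) → Σ≤ n (λ k → f k +ℚ g k) ≡ Σ≤ n f +ℚ Σ≤ n g
Σ≤-+ zero    f g = refl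
Σ≤-+ (suc n) f g rewrite Σ≤-+ n f g =
  solve 4 (λ a b c d → (a :+ b) :+ (c :+ d) := (a :+ c) :+ (b :+ d)) refl
    (Σ≤ n f) (Σ≤ n g) (f (suc n)) (g (suc n))

Σ≤-*ˡ : ∀ n a (f : ℕ → ℚ) → Σ≤ n (λ k → a *ℚ f k) ≡ a *ℚ Σ≤ n f
Σ≤-*ˡ zero    a f = refl
Σ≤-*ˡ (suc n) a f rewrite Σ≤-*ˡ n a f = sym (ℚP.*-distribˡ-+ a (Σ≤ n f) (f (suc n)))

Σ≤-split-first : ∀ n (f : ℕ → ℚ) → Σ≤ (suc n) f ≡ f 0 +ℚ Σ≤ n (λ k → f (suc k))
Σ≤-split-first zero    f = refl
Σ≤-split-first (suc n) f rewrite Σ≤-split-first n f =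
  ℚP.+-assoc (f 0) (Σ≤ n (λ k → f (suc k))) (f (suc (suc n)))

Σ≤-shift : ∀ n (f : ℕ → ℚ) → f 0 ≡ 0ℚ → f (suc n) ≡ 0ℚ →
           Σ≤ n f ≡ Σ≤ n (λ k → f (suc k))
Σ≤-shift n f f0≡0 fn+1≡0 = begin
  Σ≤ n f                             ≡⟨ sym (ℚP.+-identityʳ (Σ≤ n f)) ⟩
  Σ≤ n f +ℚ 0ℚ                       ≡⟨ cong (Σ≤ n f +ℚ_) (sym fn+1≡0) ⟩
  Σ≤ (suc n) f                       ≡⟨ Σ≤-split-first n f ⟩
  f 0 +ℚ Σ≤ n (λ k → f (suc k))      ≡⟨ cong (_+ℚ Σ≤ n (λ k → f (suc k))) f0≡0 ⟩
  0ℚ +ℚ Σ≤ n (λ k → f (suc k))       ≡⟨ ℚP.+-identityˡ _ ⟩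
  Σ≤ n (λ k → f (suc k))             ∎

Σ≤-telescope : ∀ (R t : ℕ → ℚ) → R 0 ≡ 0ℚ → (∀ i → R (suc i) ≡ R i +ℚ t i) →
               ∀ N → Σ≤ N t ≡ R (suc N)
Σ≤-telescope R t R0≡0 step zero =
  sym (trans (step 0) (trans (cong (_+ℚ t 0) R0≡0) (ℚP.+-identityˡ (t 0))))
Σ≤-telescope R t R0≡0 step (suc N) =
  trans (cong (_+ℚ t (suc N)) (Σ≤-telescope R t R0≡0 step N)) (sym (step (suc N)))

ζ-lower : ℕ → ℕ → ℚ
ζ-lower i zero    = 0ℚ
ζ-lower i (suc k) = ζ i k

-- The analogous
-- recursion ζ*_{i+1}({1}_{K+1}) = ζ*_i({1}_{K+1}) + ζ*_{i+1}({1}_K) / (i+1)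
-- holds definitionally and is used directly in ζζ⋆-tier-step.
ζ-tier-step : ∀ i k → ζ (suc i) k ≡ ζ i k +ℚ inv-suc i *ℚ ζ-lower i k
ζ-tier-step i zero    = solve 1 (λ a → con 1ℚ := con 1ℚ :+ a :* con 0ℚ) refl (inv-suc i)
ζ-tier-step i (suc k) = refl

ζζ⋆-tier-step : ∀ i s k {X} K → X ≡ suc K →
  s *ℚ ζ (suc i) k *ℚ ζ⋆ (suc i) X
    ≡ s *ℚ ζ i k *ℚ ζ⋆ i X
      +ℚ inv-suc i *ℚ (s *ℚ ζ i k *ℚ ζ⋆ (suc i) K +ℚ s *ℚ ζ-lower i k *ℚ ζ⋆ (suc i) X)
ζζ⋆-tier-step i s k K refl rewrite ζ-tier-step i k =
  solve 6 (λ s z z₋ h⋆ h⋆₊ a →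
      s :* (z :+ a :* z₋) :* (h⋆ :+ a :* h⋆₊)
    := s :* z :* h⋆ :+ a :* (s :* z :* h⋆₊ :+ s :* z₋ :* (h⋆ :+ a :* h⋆₊)))
    refl s (ζ i k) (ζ-lower i k) (ζ⋆ i (suc K)) (ζ⋆ (suc i) K) (inv-suc i)

ζζ⋆-tier-zero : ∀ s k {X} K → X ≡ suc K → s *ℚ ζ 0 k *ℚ ζ⋆ 0 X ≡ 0ℚ
ζζ⋆-tier-zero s zero    K refl = ℚP.*-zeroʳ (s *ℚ 1ℚ)
ζζ⋆-tier-zero s (suc k) K refl = ℚP.*-zeroʳ (s *ℚ 0ℚ)

+1∸-≤ : ∀ K {j} → j ≤ K → K + 1 ∸ j ≡ suc (K ∸ j)
+1∸-≤ K {j} j≤K = trans (ℕP.+-∸-comm 1 j≤K) (ℕP.+-comm (K ∸ j) 1)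

+1∸-suc : ∀ K j → K + 1 ∸ suc j ≡ K ∸ j
+1∸-suc K j rewrite ℕP.+-comm K 1 = refl

module TierSums (n m : ℕ) where

  c d : ℕ → ℚ
  c j = ℕ→ℚ ((n + m + 1 ∸ j) C (m + 1))
  d j = ℕ→ℚ ((n + m ∸ j) C m)

  R : ℕ → ℚ
  R M = Σ≤ n (λ j → sgn j *ℚ c j *ℚ ζ M j *ℚ ζ⋆ M (n + m + 1 ∸ j))

  c-pascal : ∀ {j} → j ≤ n → c j ≡ d j +ℚ c (suc j)
  c-pascal {j} j≤n = begin
    c j                                            ≡⟨ cong (λ X → ℕ→ℚ (X C (m + 1))) (+1∸-≤ (n + m) j≤n+m) ⟩
    ℕ→ℚ (suc (n + m ∸ j) C (m + 1))                ≡⟨ pascal (n + m ∸ j) m ⟩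
    d j +ℚ ℕ→ℚ ((n + m ∸ j) C (m + 1))             ≡⟨ cong (λ Y → d j +ℚ ℕ→ℚ (Y C (m + 1))) (sym (+1∸-suc (n + m) j)) ⟩
    d j +ℚ c (suc j)                               ∎
    where j≤n+m = ℕP.≤-trans j≤n (ℕP.m≤m+n n m)

  c-past-end : c (suc n) ≡ 0ℚ
  c-past-end = begin
    c (suc n)                      ≡⟨ cong (λ X → ℕ→ℚ (X C (m + 1))) (+1∸-suc (n + m) n) ⟩
    ℕ→ℚ ((n + m ∸ n) C (m + 1))    ≡⟨ cong (λ X → ℕ→ℚ (X C (m + 1))) (ℕP.m+n∸m≡n n m) ⟩
    ℕ→ℚ (m C (m + 1))              ≡⟨ cong ℕ→ℚ (k>n⇒nCk≡0 (ℕP.≤-reflexive (ℕP.+-comm 1 m))) ⟩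
    0ℚ                             ∎

  R-tier-zero : R 0 ≡ 0ℚ
  R-tier-zero = Σ≤-vanish n _ (λ j j≤n →
    ζζ⋆-tier-zero (sgn j *ℚ c j) j (n + m ∸ j) (+1∸-≤ (n + m) (ℕP.≤-trans j≤n (ℕP.m≤m+n n m))))

  module RaiseTier (i : ℕ) where

    -- the two sums created by raising the tier, and the summand of (n,m)_i
    A B W : ℕ → ℚ
    A j = sgn j *ℚ c j *ℚ ζ i j *ℚ ζ⋆ (suc i) (n + m ∸ j)
    B j = sgn j *ℚ c j *ℚ ζ-lower i j *ℚ ζ⋆ (suc i) (n + m + 1 ∸ j)
    W j = sgn j *ℚ ℕ→ℚ ((n ∸ j + m) C m) *ℚ ζ i j *ℚ ζ⋆ (suc i) (n ∸ j + m)

    B-shift : Σ≤ n B ≡ Σ≤ n (λ j → B (suc j))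
    B-shift = Σ≤-shift n B B-first B-past-end
      where
      B-first : B 0 ≡ 0ℚ
      B-first = trans (cong (_*ℚ ζ⋆ (suc i) (n + m + 1)) (ℚP.*-zeroʳ (sgn 0 *ℚ c 0)))
                      (ℚP.*-zeroˡ (ζ⋆ (suc i) (n + m + 1)))
      B-past-end : B (suc n) ≡ 0ℚ
      B-past-end = begin
        B (suc n)  ≡⟨ cong (λ x → sgn (suc n) *ℚ x *ℚ ζ i n *ℚ ζ⋆ (suc i) (n + m + 1 ∸ suc n)) c-past-end ⟩
        sgn (suc n) *ℚ 0ℚ *ℚ ζ i n *ℚ ζ⋆ (suc i) (n + m + 1 ∸ suc n)
          ≡⟨ solve 3 (λ s z h → s :* con 0ℚ :* z :* h := con 0ℚ) refl
               (sgn (suc n)) (ζ i n) (ζ⋆ (suc i) (n + m + 1 ∸ suc n)) ⟩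
        0ℚ         ∎

    -- Merging A with the shifted B is Pascal's rule, summand by summand.
    merge : ∀ j → j ≤ n → A j +ℚ B (suc j) ≡ W j
    merge j j≤n = begin
      A j +ℚ B (suc j)
        ≡⟨ cong (λ X → A j +ℚ (- sgn j) *ℚ c (suc j) *ℚ ζ i j *ℚ ζ⋆ (suc i) X) (+1∸-suc (n + m) j) ⟩
      sgn j *ℚ c j *ℚ z *ℚ h +ℚ (- sgn j) *ℚ c (suc j) *ℚ z *ℚ h
        ≡⟨ cong (λ x → sgn j *ℚ x *ℚ z *ℚ h +ℚ (- sgn j) *ℚ c (suc j) *ℚ z *ℚ h) (c-pascal j≤n) ⟩
      sgn j *ℚ (d j +ℚ c (suc j)) *ℚ z *ℚ h +ℚ (- sgn j) *ℚ c (suc j) *ℚ z *ℚ h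
        ≡⟨ solve 5 (λ s dd cc z h → s :* (dd :+ cc) :* z :* h :+ (:- s) :* cc :* z :* h := s :* dd :* z :* h)
             refl (sgn j) (d j) (c (suc j)) z h ⟩
      sgn j *ℚ d j *ℚ z *ℚ h
        ≡⟨ cong (λ Y → sgn j *ℚ ℕ→ℚ (Y C m) *ℚ ζ i j *ℚ ζ⋆ (suc i) Y) (ℕP.+-∸-comm m j≤n) ⟩
      W j ∎
      where
      z = ζ i j
      h = ζ⋆ (suc i) (n + m ∸ j)

    R-tier-step : R (suc i) ≡ R i +ℚ tierBinom i n m
    R-tier-step = begin
      R (suc i)
        ≡⟨ Σ≤-cong n (λ j j≤n → ζζ⋆-tier-step i (sgn j *ℚ c j) j (n + m ∸ j)
                                  (+1∸-≤ (n + m) (ℕP.≤-trans j≤n (ℕP.m≤m+n n m)))) ⟩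
      Σ≤ n (λ j → T j +ℚ inv-suc i *ℚ (A j +ℚ B j))
        ≡⟨ Σ≤-+ n T _ ⟩
      R i +ℚ Σ≤ n (λ j → inv-suc i *ℚ (A j +ℚ B j))
        ≡⟨ cong (R i +ℚ_) (Σ≤-*ˡ n (inv-suc i) _) ⟩
      R i +ℚ inv-suc i *ℚ Σ≤ n (λ j → A j +ℚ B j)
        ≡⟨ cong (λ S → R i +ℚ inv-suc i *ℚ S) differences ⟩
      R i +ℚ tierBinom i n m ∎
      where
      T : ℕ → ℚ
      T j = sgn j *ℚ c j *ℚ ζ i j *ℚ ζ⋆ i (n + m + 1 ∸ j)
      differences : Σ≤ n (λ j → A j +ℚ B j) ≡ Σ≤ n W
      differences = begin
        Σ≤ n (λ j → A j +ℚ B j)            ≡⟨ Σ≤-+ n A B ⟩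
        Σ≤ n A +ℚ Σ≤ n B                   ≡⟨ cong (Σ≤ n A +ℚ_) B-shift ⟩
        Σ≤ n A +ℚ Σ≤ n (λ j → B (suc j))   ≡⟨ sym (Σ≤-+ n A (λ j → B (suc j))) ⟩
        Σ≤ n (λ j → A j +ℚ B (suc j))      ≡⟨ Σ≤-cong n merge ⟩
        Σ≤ n W                             ∎

proposition3p16 : (N n m : ℕ) →
    Σ≤ N (λ i → tierBinom i n m)
      ≡ Σ≤ n (λ j → sgn j *ℚ ℕ→ℚ ((n + m + 1 ∸ j) C (m + 1)) *ℚ ζ (suc N) j *ℚ ζ⋆ (suc N) (n + m + 1 ∸ j))
proposition3p16 N n m =
  Σ≤-telescope R (λ i → tierBinom i n m) R-tier-zero (λ i → RaiseTier.R-tier-step i) N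
  where open TierSums n m
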